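{- Let $v\equiv 9,17\pmod{20}$. Then there is no decomposition of the edge set of $K_v$ into $2$ copies of $K_3$, $5$ copies of $K_4$ and $\frac{v^2-v-72}{20}$ copies of $K_5$.
   Context: A decomposition of the edge set of $K_v$ into cliques means a collection of complete subgraphs of $K_v$ such that every edge of $K_v$ lies in exactly one of them. -}

module Defs where

open import Data.Nat using (ℕ; _≡ᵇ_)
open import Data.Fin using (Fin)
open import Data.List using (List; length; filter; map)
open import Data.List.Relation.Unary.All using (All)
open import Data.List.Relation.Unary.Unique.Propositional using (Unique)
open import Data.List.Membership.Propositional using (_∈_)
open import Data.List.Membership.DecPropositional using ()
open import Data.List.Relation.Unary.Any using (any?)
open import Data.Fin.Properties using (_≟_)
open import Data.Product using (_×_)
open import Relation.Binary.PropositionalEquality using (_≡_)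
open import Relation.Nullary using (¬_)
open import Relation.Nullary.Decidable using (_×-dec_)

-- A clique (complete subgraph) of K_v is given by its vertex set,
-- represented as a duplicate-free list of vertices of K_v; its order is the length.
Clique : ℕ → Set
Clique v = List (Fin v)

edgeIn : ∀ {v} → Fin v → Fin v → Clique v → Set
edgeIn x y B = (x ∈ B) × (y ∈ B)

coverCount : ∀ {v} → Fin v → Fin v → List (Clique v) → ℕ
coverCount x y Bs =
  length (filter (λ B → any? (λ z → x ≟ z) B ×-dec any? (λ z → y ≟ z) B) Bs)

IsCliqueDecomposition : (v : ℕ) → List (Clique v) → Set
IsCliqueDecomposition v Bs =
  All Unique Bs × (∀ (x y : Fin v) → ¬ (x ≡ y) → coverCount x y Bs ≡ 1)

numOfOrder : ∀ {v} → ℕ → List (Clique v) → ℕ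
numOfOrder k Bs = length (filter (λ B → Data.Nat._≟_ (length B) k) Bs)

-- For a vertex x let rₖ(x) be the number of blocks of order k through x. The blocks through x
-- partition the edges at x, so 2 r₃(x) + 3 r₄(x) + 4 r₅(x) = v − 1 ≡ 0 (mod 4); hence
-- r₄(x) ≠ 1, and r₄(x) = 2 forces r₃(x) ≥ 1. Thus every vertex of a K₄ lies in at least two
-- K₄'s; as each of the other four K₄'s meets it in at most one vertex, each of its vertices
-- lies in exactly two. So r₄ ≤ 2 r₃ everywhere, and summing over the vertices gives
-- 4·5 ≤ 2·(3·2).
module Submission where

open import Data.Empty using (⊥-elim)
open import Data.Fin using (Fin)
open import Data.Fin.Properties using (_≟_)
open import Data.List using (List; []; _∷_; length; filter; _++_; allFin)
open import Data.List.Membership.Propositional using (_∈_; _∉_)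
open import Data.List.Membership.Propositional.Properties using (∈-allFin; ∈-∃++)
open import Data.List.Properties using (length-tabulate)
open import Data.List.Relation.Unary.All as All using (All)
open import Data.List.Relation.Unary.All.Properties using (All¬⇒¬Any)
open import Data.List.Relation.Unary.AllPairs using (_∷_)
open import Data.List.Relation.Unary.Any using (here; there; any?)
open import Data.List.Relation.Unary.Unique.Propositional using (Unique)
open import Data.List.Relation.Unary.Unique.Propositional.Properties using (allFin⁺)
open import Data.Nat as ℕ using (ℕ; zero; suc; _+_; _*_; _∸_; _/_; _%_; _≤_; z≤n; s≤s; NonZero)
open import Data.Nat.DivMod using (m≡m%n+[m/n]*n; [m+kn]%n≡m%n; m∣n⇒o%n%m≡o%m)
open import Data.Nat.Divisibility using (divides)
open import Data.Nat.Properties hiding (_≟_)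
open import Data.Nat.Tactic.RingSolver using (solve-∀)
open import Data.Product using (Σ; _×_; _,_; proj₁; proj₂)
open import Data.Sum using (_⊎_; inj₁; inj₂)
open import Function using (id)
open import Level using (Level)
open import Relation.Binary.PropositionalEquality
open import Relation.Nullary using (¬_; Dec; yes; no)
open import Relation.Nullary.Decidable using (_×-dec_; from-no)
open import Relation.Unary using (Decidable)

open import Defs

private
  variable
    a p p′ : Level
    A : Set a
    P : Set p
    Q : Set p′

𝟙 : Dec P → ℕ
𝟙 (yes _) = 1
𝟙 (no _)  = 0

𝟙≤1 : (d : Dec P) → 𝟙 d ≤ 1
𝟙≤1 (yes _) = s≤s z≤n
𝟙≤1 (no _)  = z≤n

𝟙-yes : (d : Dec P) → P → 𝟙 d ≡ 1
𝟙-yes (yes _) _  = refl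
𝟙-yes (no ¬p) p  = ⊥-elim (¬p p)

𝟙-no : (d : Dec P) → ¬ P → 𝟙 d ≡ 0
𝟙-no (yes p) ¬p = ⊥-elim (¬p p)
𝟙-no (no _)  _  = refl

𝟙-idem : (d : Dec P) → 𝟙 d * 𝟙 d ≡ 𝟙 d
𝟙-idem (yes _) = refl
𝟙-idem (no _)  = refl

𝟙-×-dec : (d : Dec P) (e : Dec Q) → 𝟙 (d ×-dec e) ≡ 𝟙 d * 𝟙 e
𝟙-×-dec (yes _) (yes _) = refl
𝟙-×-dec (yes _) (no _)  = refl
𝟙-×-dec (no _)  _       = refl

𝟙*𝟙-pos : (d : Dec P) (e : Dec Q) → 1 ≤ 𝟙 d * 𝟙 e → P × Q
𝟙*𝟙-pos (yes p) (yes q) _ = p , q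
𝟙*𝟙-pos (yes _) (no _)  ()
𝟙*𝟙-pos (no _)  _       ()

∑ : List A → (A → ℕ) → ℕ
∑ []       f = 0
∑ (x ∷ xs) f = f x + ∑ xs f

infix 8 ∑
syntax ∑ L (λ x → e) = ∑[ x ∈ L ] e

module _ {A : Set a} where

  ∑-++ : ∀ xs ys (f : A → ℕ) → ∑ (xs ++ ys) f ≡ ∑ xs f + ∑ ys f
  ∑-++ []       ys f = refl
  ∑-++ (x ∷ xs) ys f = trans (cong (f x +_) (∑-++ xs ys f)) (sym (+-assoc (f x) _ _))

  ∑-middle : ∀ xs (y : A) ys f → ∑ (xs ++ y ∷ ys) f ≡ f y + ∑ (xs ++ ys) f
  ∑-middle xs y ys f = begin
    ∑ (xs ++ y ∷ ys) f          ≡⟨ ∑-++ xs (y ∷ ys) f ⟩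
    ∑ xs f + (f y + ∑ ys f)     ≡⟨ reorder (∑ xs f) (f y) (∑ ys f) ⟩
    f y + (∑ xs f + ∑ ys f)     ≡⟨ cong (f y +_) (∑-++ xs ys f) ⟨
    f y + ∑ (xs ++ ys) f        ∎
    where
    open ≡-Reasoning
    reorder : ∀ m n o → m + (n + o) ≡ n + (m + o)
    reorder = solve-∀

  ∑-+ : ∀ L (f g : A → ℕ) → ∑[ x ∈ L ] (f x + g x) ≡ ∑ L f + ∑ L g
  ∑-+ []      f g = refl
  ∑-+ (x ∷ L) f g rewrite ∑-+ L f g = interchange (f x) (g x) (∑ L f) (∑ L g)
    where
    interchange : ∀ m n o r → m + n + (o + r) ≡ m + o + (n + r)
    interchange = solve-∀

  ∑-*ˡ : ∀ k L (f : A → ℕ) → ∑[ x ∈ L ] (k * f x) ≡ k * ∑ L f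
  ∑-*ˡ k []      f = sym (*-zeroʳ k)
  ∑-*ˡ k (x ∷ L) f rewrite ∑-*ˡ k L f = sym (*-distribˡ-+ k (f x) (∑ L f))

  ∑-*ʳ : ∀ k L (f : A → ℕ) → ∑[ x ∈ L ] (f x * k) ≡ ∑ L f * k
  ∑-*ʳ k []      f = refl
  ∑-*ʳ k (x ∷ L) f rewrite ∑-*ʳ k L f = sym (*-distribʳ-+ k (f x) (∑ L f))

  ∑-cong : ∀ L {f g : A → ℕ} → (∀ {x} → x ∈ L → f x ≡ g x) → ∑ L f ≡ ∑ L g
  ∑-cong []      eq = refl
  ∑-cong (x ∷ L) eq = cong₂ _+_ (eq (here refl)) (∑-cong L (λ x∈L → eq (there x∈L)))

  ∑-mono-≤ : ∀ L {f g : A → ℕ} → (∀ {x} → x ∈ L → f x ≤ g x) → ∑ L f ≤ ∑ L g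
  ∑-mono-≤ []      le = z≤n
  ∑-mono-≤ (x ∷ L) le = +-mono-≤ (le (here refl)) (∑-mono-≤ L (λ x∈L → le (there x∈L)))

  ∑-zero : ∀ (L : List A) → ∑[ x ∈ L ] 0 ≡ 0
  ∑-zero []      = refl
  ∑-zero (x ∷ L) = ∑-zero L

  ∑-one : ∀ (L : List A) → ∑[ x ∈ L ] 1 ≡ length L
  ∑-one []      = refl
  ∑-one (x ∷ L) = cong suc (∑-one L)

  ∑-≤-length : ∀ L {f : A → ℕ} → (∀ x → f x ≤ 1) → ∑ L f ≤ length L
  ∑-≤-length L f≤1 = ≤-trans (∑-mono-≤ L (λ {x} _ → f≤1 x)) (≤-reflexive (∑-one L))

  ∑≡0⇒≡0 : ∀ L {f : A → ℕ} → ∑ L f ≡ 0 → ∀ {x} → x ∈ L → f x ≡ 0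
  ∑≡0⇒≡0 (y ∷ L) {f} eq (here refl) = m+n≡0⇒m≡0 (f y) eq
  ∑≡0⇒≡0 (y ∷ L) {f} eq (there x∈L) = ∑≡0⇒≡0 L (m+n≡0⇒n≡0 (f y) eq) x∈L

  ∑>0⇒>0 : ∀ L {f : A → ℕ} → 1 ≤ ∑ L f → Σ A λ x → x ∈ L × 1 ≤ f x
  ∑>0⇒>0 (y ∷ L) {f} pos with f y in eq
  ... | zero  = let x , x∈L , fx>0 = ∑>0⇒>0 L pos in x , there x∈L , fx>0
  ... | suc _ = y , here refl , ≤-trans (s≤s z≤n) (≤-reflexive (sym eq))

  private
    saturated : ∀ {m n k} → m ≤ 1 → n ≤ k → m + n ≡ suc k → m ≡ 1 × n ≡ k
    saturated {zero}        _        n≤k eq = ⊥-elim (1+n≰n (≤-trans (≤-reflexive (sym eq)) n≤k))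
    saturated {suc zero}    _        _   eq = refl , suc-injective eq
    saturated {suc (suc _)} (s≤s ()) _   _

  ∑≡length⇒≡1 : ∀ L {f : A → ℕ} → (∀ x → f x ≤ 1) → ∑ L f ≡ length L →
                ∀ {x} → x ∈ L → f x ≡ 1
  ∑≡length⇒≡1 (y ∷ L) {f} f≤1 eq x∈yL
    with fy≡1 , ∑L≡length ← saturated (f≤1 y) (∑-≤-length L f≤1) eq
       | x∈yL
  ... | here refl = fy≡1
  ... | there x∈L = ∑≡length⇒≡1 L f≤1 ∑L≡length x∈L

  term+k*length≤∑+k : ∀ k L {f : A → ℕ} → (∀ {y} → y ∈ L → k ≤ f y) →
                      ∀ {x} → x ∈ L → f x + k * length L ≤ ∑ L f + k
  term+k*length≤∑+k k (w ∷ L) {f} k≤f (here refl) = begin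
    f w + k * suc (length L)  ≡⟨ shift (f w) k (length L) ⟩
    f w + k * length L + k    ≤⟨ +-monoˡ-≤ k (+-monoʳ-≤ (f w) (const≤∑ L k≤f-tail)) ⟩
    f w + ∑ L f + k           ∎
    where
    open ≤-Reasoning
    shift : ∀ m k n → m + k * suc n ≡ m + k * n + k
    shift = solve-∀
    k≤f-tail : ∀ {y} → y ∈ L → k ≤ f y
    k≤f-tail y∈L = k≤f (there y∈L)
    const≤∑ : ∀ L → (∀ {y} → y ∈ L → k ≤ f y) → k * length L ≤ ∑ L f
    const≤∑ []      _   = ≤-reflexive (*-zeroʳ k)
    const≤∑ (y ∷ L) k≤f = begin
      k * suc (length L)  ≡⟨ *-suc k (length L) ⟩
      k + k * length L    ≤⟨ +-mono-≤ (k≤f (here refl)) (const≤∑ L (λ y∈L → k≤f (there y∈L))) ⟩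
      f y + ∑ L f         ∎
  term+k*length≤∑+k k (w ∷ L) {f} k≤f {x} (there x∈L) = begin
    f x + k * suc (length L)  ≡⟨ shift (f x) k (length L) ⟩
    k + (f x + k * length L)  ≤⟨ +-mono-≤ (k≤f (here refl))
                                          (term+k*length≤∑+k k L (λ y∈L → k≤f (there y∈L)) x∈L) ⟩
    f w + (∑ L f + k)         ≡⟨ +-assoc (f w) (∑ L f) k ⟨
    f w + ∑ L f + k           ∎
    where
    open ≤-Reasoning
    shift : ∀ m k n → m + k * suc n ≡ k + (m + k * n)
    shift = solve-∀

  ∑≤1 : ∀ L {f : A → ℕ} → Unique L → (∀ x → f x ≤ 1) →
        (∀ {y z} → y ∈ L → z ∈ L → y ≢ z → f y * f z ≡ 0) → ∑ L f ≤ 1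
  ∑≤1 []      _ _ _ = z≤n
  ∑≤1 (w ∷ L) {f} (w∉L ∷ uL) f≤1 disjoint with f w in eq | f≤1 w
  ... | zero     | _ = ∑≤1 L uL f≤1 (λ y∈L z∈L → disjoint (there y∈L) (there z∈L))
  ... | suc zero | _ = s≤s (≤-reflexive (trans (∑-cong L rest≡0) (∑-zero L)))
    where
    rest≡0 : ∀ {z} → z ∈ L → f z ≡ 0
    rest≡0 {z} z∈L = begin
      f z        ≡⟨ *-identityˡ (f z) ⟨
      1 * f z    ≡⟨ cong (_* f z) eq ⟨
      f w * f z  ≡⟨ disjoint (here refl) (there z∈L) (All.lookup w∉L z∈L) ⟩
      0          ∎
      where open ≡-Reasoning
  ... | suc (suc _) | s≤s ()

  ∑-all-but-one : ∀ L {f : A → ℕ} → Unique L → ∀ {x} → x ∈ L →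
                  (∀ {y} → x ≢ y → f y ≡ 1) → ∑ L f + 1 ≡ f x + length L
  ∑-all-but-one (x ∷ L) {f} (x∉L ∷ _) (here refl) others≡1 = begin
    f x + ∑ L f + 1           ≡⟨ +-assoc (f x) (∑ L f) 1 ⟩
    f x + (∑ L f + 1)         ≡⟨ cong (λ n → f x + (n + 1)) (trans (∑-cong L rest≡1) (∑-one L)) ⟩
    f x + (length L + 1)      ≡⟨ cong (f x +_) (+-comm (length L) 1) ⟩
    f x + suc (length L)      ∎
    where
    open ≡-Reasoning
    rest≡1 : ∀ {y} → y ∈ L → f y ≡ 1
    rest≡1 y∈L = others≡1 (All.lookup x∉L y∈L)
  ∑-all-but-one (w ∷ L) {f} (w∉L ∷ uL) {x} (there x∈L) others≡1 = begin
    f w + ∑ L f + 1           ≡⟨ +-assoc (f w) (∑ L f) 1 ⟩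
    f w + (∑ L f + 1)         ≡⟨ cong₂ _+_ (others≡1 (λ { refl → All.lookup w∉L x∈L refl }))
                                           (∑-all-but-one L uL x∈L others≡1) ⟩
    1 + (f x + length L)      ≡⟨ +-suc (f x) (length L) ⟨
    f x + suc (length L)      ∎
    where open ≡-Reasoning

  length-filter≡∑𝟙 : ∀ {P : A → Set p} (P? : Decidable P) L →
                     length (filter P? L) ≡ ∑[ x ∈ L ] 𝟙 (P? x)
  length-filter≡∑𝟙 P? []      = refl
  length-filter≡∑𝟙 P? (x ∷ L) with P? x
  ... | yes _ = cong suc (length-filter≡∑𝟙 P? L)
  ... | no _  = length-filter≡∑𝟙 P? L

∑-swap : ∀ {b} {B : Set b} L M (f : A → B → ℕ) →
         ∑[ x ∈ L ] ∑[ y ∈ M ] f x y ≡ ∑[ y ∈ M ] ∑[ x ∈ L ] f x y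
∑-swap []      M f = sym (∑-zero M)
∑-swap (x ∷ L) M f rewrite ∑-swap L M f = sym (∑-+ M (f x) (λ y → ∑[ x ∈ L ] f x y))

module _ {v : ℕ} where

  mem : Fin v → List (Fin v) → ℕ
  mem x C = 𝟙 (any? (x ≟_) C)

  mem≤1 : ∀ x C → mem x C ≤ 1
  mem≤1 x C = 𝟙≤1 (any? (x ≟_) C)

  mem-∈ : ∀ {x C} → x ∈ C → mem x C ≡ 1
  mem-∈ {x} {C} = 𝟙-yes (any? (x ≟_) C)

  mem-∷ : ∀ x {y B} → y ∉ B → mem x (y ∷ B) ≡ 𝟙 (x ≟ y) + mem x B
  mem-∷ x {y} {B} y∉B with x ≟ y | any? (x ≟_) B
  ... | yes refl | yes x∈B = ⊥-elim (y∉B x∈B)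
  ... | yes _    | no _    = refl
  ... | no _     | yes _   = refl
  ... | no _     | no _    = refl

  ∑-𝟙≟-∉ : ∀ {y : Fin v} L → y ∉ L → ∑[ x ∈ L ] 𝟙 (x ≟ y) ≡ 0
  ∑-𝟙≟-∉ {y} L y∉L =
    trans (∑-cong L (λ {x} x∈L → 𝟙-no (x ≟ y) (λ { refl → y∉L x∈L }))) (∑-zero L)

  ∑-𝟙≟-∈ : ∀ {y : Fin v} L → Unique L → y ∈ L → ∑[ x ∈ L ] 𝟙 (x ≟ y) ≡ 1
  ∑-𝟙≟-∈ {y} (y ∷ L) (y∉L ∷ _) (here refl) =
    cong₂ _+_ (𝟙-yes (y ≟ y) refl) (∑-𝟙≟-∉ L (All¬⇒¬Any y∉L))
  ∑-𝟙≟-∈ {y} (w ∷ L) (w∉L ∷ uL) (there y∈L) =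
    cong₂ _+_ (𝟙-no (w ≟ y) (λ { refl → All.lookup w∉L y∈L refl })) (∑-𝟙≟-∈ L uL y∈L)

  ∑-mem : ∀ B → Unique B → ∑[ x ∈ allFin v ] mem x B ≡ length B
  ∑-mem []      _          = ∑-zero (allFin v)
  ∑-mem (y ∷ B) (y∉B ∷ uB) = begin
    ∑[ x ∈ allFin v ] mem x (y ∷ B)
      ≡⟨ ∑-cong (allFin v) (λ {x} _ → mem-∷ x (All¬⇒¬Any y∉B)) ⟩
    ∑[ x ∈ allFin v ] (𝟙 (x ≟ y) + mem x B)
      ≡⟨ ∑-+ (allFin v) _ _ ⟩
    ∑[ x ∈ allFin v ] 𝟙 (x ≟ y) + ∑[ x ∈ allFin v ] mem x B
      ≡⟨ cong₂ _+_ (∑-𝟙≟-∈ (allFin v) (allFin⁺ v) (∈-allFin y)) (∑-mem B uB) ⟩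
    suc (length B)
      ∎
    where open ≡-Reasoning

δ : ℕ → ℕ → ℕ
δ n k = 𝟙 (n ℕ.≟ k)

hasOrder : ∀ {v} → ℕ → Clique v → ℕ
hasOrder k C = δ (length C) k

δ-subst : ∀ (w : ℕ → ℕ) n k → w n * δ n k ≡ w k * δ n k
δ-subst w n k with n ℕ.≟ k
... | yes refl = refl
... | no _     = trans (*-zeroʳ (w n)) (sym (*-zeroʳ (w k)))

δ₃+δ₄+δ₅≤1 : ∀ n → δ n 3 + δ n 4 + δ n 5 ≤ 1
δ₃+δ₄+δ₅≤1 n with n ℕ.≟ 3 | n ℕ.≟ 4 | n ℕ.≟ 5
... | yes refl | no _     | no _     = s≤s z≤n
... | no _     | yes refl | no _     = s≤s z≤n
... | no _     | no _     | yes refl = s≤s z≤n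
... | no _     | no _     | no _     = z≤n
... | yes refl | yes ()   | _
... | yes refl | no _     | yes ()
... | no _     | yes refl | yes ()

δ-weights : ∀ (w : ℕ → ℕ) n → δ n 3 + δ n 4 + δ n 5 ≡ 1 →
            w n ≡ w 3 * δ n 3 + w 4 * δ n 4 + w 5 * δ n 5
δ-weights w n partition = begin
  w n                                       ≡⟨ *-identityʳ (w n) ⟨
  w n * 1                                   ≡⟨ cong (w n *_) partition ⟨
  w n * (δ n 3 + δ n 4 + δ n 5)             ≡⟨ distrib (w n) (δ n 3) (δ n 4) (δ n 5) ⟩
  w n * δ n 3 + w n * δ n 4 + w n * δ n 5   ≡⟨ cong₂ _+_ (cong₂ _+_ (δ-subst w n 3) (δ-subst w n 4))
                                                         (δ-subst w n 5) ⟩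
  w 3 * δ n 3 + w 4 * δ n 4 + w 5 * δ n 5   ∎
  where
  open ≡-Reasoning
  distrib : ∀ m a b c → m * (a + b + c) ≡ m * a + m * b + m * c
  distrib = solve-∀

coverCount≡∑ : ∀ {v} (x y : Fin v) Bs → coverCount x y Bs ≡ ∑[ C ∈ Bs ] (mem x C * mem y C)
coverCount≡∑ x y Bs = trans (length-filter≡∑𝟙 _ Bs)
  (∑-cong Bs (λ {C} _ → 𝟙-×-dec (any? (x ≟_) C) (any? (y ≟_) C)))

numOfOrder≡∑ : ∀ {v} k (Bs : List (Clique v)) → numOfOrder k Bs ≡ ∑ Bs (hasOrder k)
numOfOrder≡∑ k Bs = length-filter≡∑𝟙 _ Bs

orders-from-counts : ∀ {v} (Bs : List (Clique v)) →
  numOfOrder 3 Bs + numOfOrder 4 Bs + numOfOrder 5 Bs ≡ length Bs →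
  ∀ {C} → C ∈ Bs → δ (length C) 3 + δ (length C) 4 + δ (length C) 5 ≡ 1
orders-from-counts Bs counts = ∑≡length⇒≡1 Bs (λ C → δ₃+δ₄+δ₅≤1 (length C)) (begin
  ∑[ C ∈ Bs ] (hasOrder 3 C + hasOrder 4 C + hasOrder 5 C)
    ≡⟨ ∑-+ Bs _ (hasOrder 5) ⟩
  ∑[ C ∈ Bs ] (hasOrder 3 C + hasOrder 4 C) + ∑ Bs (hasOrder 5)
    ≡⟨ cong (_+ ∑ Bs (hasOrder 5)) (∑-+ Bs (hasOrder 3) (hasOrder 4)) ⟩
  ∑ Bs (hasOrder 3) + ∑ Bs (hasOrder 4) + ∑ Bs (hasOrder 5)
    ≡⟨ cong₂ _+_ (cong₂ _+_ (numOfOrder≡∑ 3 Bs) (numOfOrder≡∑ 4 Bs)) (numOfOrder≡∑ 5 Bs) ⟨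
  numOfOrder 3 Bs + numOfOrder 4 Bs + numOfOrder 5 Bs
    ≡⟨ counts ⟩
  length Bs
    ∎)
  where open ≡-Reasoning

m+kn≡o+ln⇒m%n≡o%n : ∀ m k o l n .{{_ : NonZero n}} → m + k * n ≡ o + l * n → m % n ≡ o % n
m+kn≡o+ln⇒m%n≡o%n m k o l n eq = begin
  m % n            ≡⟨ [m+kn]%n≡m%n m k n ⟨
  (m + k * n) % n  ≡⟨ cong (_% n) eq ⟩
  (o + l * n) % n  ≡⟨ [m+kn]%n≡m%n o l n ⟩
  o % n            ∎
  where open ≡-Reasoning

module DegreeMod4 {v r₃ r₄ r₅ : ℕ} (v%4≡1 : v % 4 ≡ 1)
                  (degree : 2 * r₃ + 3 * r₄ + 4 * r₅ + 1 ≡ v) where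

  private
    q : ℕ
    q = v / 4

    v≡1+q*4 : v ≡ 1 + q * 4
    v≡1+q*4 = trans (m≡m%n+[m/n]*n v 4) (cong (_+ q * 4) v%4≡1)

  r₄≢1 : r₄ ≢ 1
  r₄≢1 refl = 0≢1+n (m+kn≡o+ln⇒m%n≡o%n 0 (r₃ + r₅ * 2 + 2) 1 (q * 2) 2 (begin
    0 + (r₃ + r₅ * 2 + 2) * 2      ≡⟨ even r₃ r₅ ⟩
    2 * r₃ + 3 * 1 + 4 * r₅ + 1    ≡⟨ trans degree v≡1+q*4 ⟩
    1 + q * 4                      ≡⟨ cong suc (*-assoc q 2 2) ⟨
    1 + q * 2 * 2                  ∎))
    where
    open ≡-Reasoning
    even : ∀ c a → 0 + (c + a * 2 + 2) * 2 ≡ 2 * c + 3 * 1 + 4 * a + 1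
    even = solve-∀

  r₄≡2⇒r₃≢0 : r₄ ≡ 2 → r₃ ≢ 0
  r₄≡2⇒r₃≢0 refl refl = 1+n≢0 (suc-injective (m+kn≡o+ln⇒m%n≡o%n 3 (r₅ + 1) 1 q 4 (begin
    3 + (r₅ + 1) * 4               ≡⟨ three-mod-4 r₅ ⟩
    2 * 0 + 3 * 2 + 4 * r₅ + 1     ≡⟨ trans degree v≡1+q*4 ⟩
    1 + q * 4                      ∎)))
    where
    open ≡-Reasoning
    three-mod-4 : ∀ a → 3 + (a + 1) * 4 ≡ 2 * 0 + 3 * 2 + 4 * a + 1
    three-mod-4 = solve-∀

  r₄≤2⇒r₄≤2*r₃ : r₄ ≤ 2 → r₄ ≤ 2 * r₃
  r₄≤2⇒r₄≤2*r₃ r₄≤2 = cases r₄≤2 r₄≢1 r₄≡2⇒r₃≢0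
    where
    cases : ∀ {m n} → m ≤ 2 → m ≢ 1 → (m ≡ 2 → n ≢ 0) → m ≤ 2 * n
    cases {0}                  _            _   _   = z≤n
    cases {1}                  _            m≢1 _   = ⊥-elim (m≢1 refl)
    cases {2}                  _            _   n≢0 = *-monoʳ-≤ 2 (n≢0⇒n>0 (n≢0 refl))
    cases {suc (suc (suc _))} (s≤s (s≤s ())) _  _

module Replication {v : ℕ} {Bs : List (Clique v)} (decomposition : IsCliqueDecomposition v Bs)
  (orders : ∀ {C} → C ∈ Bs → δ (length C) 3 + δ (length C) 4 + δ (length C) 5 ≡ 1) where

  private
    unique : ∀ {C} → C ∈ Bs → Unique C
    unique = All.lookup (proj₁ decomposition)

    covered-once : ∀ {x y} → x ≢ y → coverCount x y Bs ≡ 1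
    covered-once = proj₂ decomposition _ _

  rep : ℕ → Fin v → ℕ
  rep k x = ∑[ C ∈ Bs ] (mem x C * hasOrder k C)

  ∑-rep : ∀ k → ∑[ x ∈ allFin v ] rep k x ≡ k * numOfOrder k Bs
  ∑-rep k = begin
    ∑[ x ∈ allFin v ] ∑[ C ∈ Bs ] (mem x C * hasOrder k C)   ≡⟨ ∑-swap (allFin v) Bs _ ⟩
    ∑[ C ∈ Bs ] ∑[ x ∈ allFin v ] (mem x C * hasOrder k C)   ≡⟨ ∑-cong Bs block-size ⟩
    ∑[ C ∈ Bs ] (length C * hasOrder k C)                     ≡⟨ ∑-cong Bs (λ {C} _ → δ-subst id (length C) k) ⟩
    ∑[ C ∈ Bs ] (k * hasOrder k C)                            ≡⟨ ∑-*ˡ k Bs (hasOrder k) ⟩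
    k * ∑ Bs (hasOrder k)                                     ≡⟨ cong (k *_) (numOfOrder≡∑ k Bs) ⟨
    k * numOfOrder k Bs                                       ∎
    where
    open ≡-Reasoning
    block-size : ∀ {C} → C ∈ Bs → ∑[ x ∈ allFin v ] (mem x C * hasOrder k C) ≡ length C * hasOrder k C
    block-size {C} C∈Bs = trans (∑-*ʳ (hasOrder k C) (allFin v) (λ x → mem x C))
                                (cong (_* hasOrder k C) (∑-mem C (unique C∈Bs)))

  ∑-by-order : ∀ (w : ℕ → ℕ) x →
               ∑[ C ∈ Bs ] (mem x C * w (length C)) ≡ w 3 * rep 3 x + w 4 * rep 4 x + w 5 * rep 5 x
  ∑-by-order w x = begin
    ∑[ C ∈ Bs ] (mem x C * w (length C))
      ≡⟨ ∑-cong Bs split-by-order ⟩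
    ∑[ C ∈ Bs ] (w 3 * (mem x C * hasOrder 3 C) + w 4 * (mem x C * hasOrder 4 C) + w 5 * (mem x C * hasOrder 5 C))
      ≡⟨ ∑-+ Bs _ _ ⟩
    ∑[ C ∈ Bs ] (w 3 * (mem x C * hasOrder 3 C) + w 4 * (mem x C * hasOrder 4 C))
      + ∑[ C ∈ Bs ] (w 5 * (mem x C * hasOrder 5 C))
      ≡⟨ cong₂ _+_ (trans (∑-+ Bs _ _) (cong₂ _+_ (∑-*ˡ (w 3) Bs _) (∑-*ˡ (w 4) Bs _)))
                   (∑-*ˡ (w 5) Bs _) ⟩
    w 3 * rep 3 x + w 4 * rep 4 x + w 5 * rep 5 x
      ∎
    where
    open ≡-Reasoning
    distrib : ∀ m a b c d e f → m * (a * d + b * e + c * f) ≡ a * (m * d) + b * (m * e) + c * (m * f)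
    distrib = solve-∀
    split-by-order : ∀ {C} → C ∈ Bs → mem x C * w (length C) ≡
      w 3 * (mem x C * hasOrder 3 C) + w 4 * (mem x C * hasOrder 4 C) + w 5 * (mem x C * hasOrder 5 C)
    split-by-order {C} C∈Bs = trans (cong (mem x C *_) (δ-weights w (length C) (orders C∈Bs)))
      (distrib (mem x C) (w 3) (w 4) (w 5) (hasOrder 3 C) (hasOrder 4 C) (hasOrder 5 C))

  ∑-coverCount : ∀ x → ∑[ y ∈ allFin v ] coverCount x y Bs ≡ ∑[ C ∈ Bs ] (mem x C * length C)
  ∑-coverCount x = begin
    ∑[ y ∈ allFin v ] coverCount x y Bs                ≡⟨ ∑-cong (allFin v) (λ {y} _ → coverCount≡∑ x y Bs) ⟩
    ∑[ y ∈ allFin v ] ∑[ C ∈ Bs ] (mem x C * mem y C)  ≡⟨ ∑-swap (allFin v) Bs _ ⟩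
    ∑[ C ∈ Bs ] ∑[ y ∈ allFin v ] (mem x C * mem y C)  ≡⟨ ∑-cong Bs block-size ⟩
    ∑[ C ∈ Bs ] (mem x C * length C)                   ∎
    where
    open ≡-Reasoning
    block-size : ∀ {C} → C ∈ Bs → ∑[ y ∈ allFin v ] (mem x C * mem y C) ≡ mem x C * length C
    block-size {C} C∈Bs = trans (∑-*ˡ (mem x C) (allFin v) (λ y → mem y C))
                                (cong (mem x C *_) (∑-mem C (unique C∈Bs)))

  coverCount-diagonal : ∀ x → coverCount x x Bs ≡ 1 * rep 3 x + 1 * rep 4 x + 1 * rep 5 x
  coverCount-diagonal x = begin
    coverCount x x Bs                  ≡⟨ coverCount≡∑ x x Bs ⟩
    ∑[ C ∈ Bs ] (mem x C * mem x C)    ≡⟨ ∑-cong Bs (λ {C} _ → trans (𝟙-idem (any? (x ≟_) C))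
                                                                    (sym (*-identityʳ (mem x C)))) ⟩
    ∑[ C ∈ Bs ] (mem x C * 1)          ≡⟨ ∑-by-order (λ _ → 1) x ⟩
    1 * rep 3 x + 1 * rep 4 x + 1 * rep 5 x ∎
    where open ≡-Reasoning

  degree : ∀ x → 2 * rep 3 x + 3 * rep 4 x + 4 * rep 5 x + 1 ≡ v
  degree x = +-cancelˡ-≡ (1 * rep 3 x + 1 * rep 4 x + 1 * rep 5 x) _ _ (begin
    1 * rep 3 x + 1 * rep 4 x + 1 * rep 5 x + (2 * rep 3 x + 3 * rep 4 x + 4 * rep 5 x + 1)
      ≡⟨ rearrange (rep 3 x) (rep 4 x) (rep 5 x) ⟩
    3 * rep 3 x + 4 * rep 4 x + 5 * rep 5 x + 1
      ≡⟨ cong (_+ 1) (trans (∑-coverCount x) (∑-by-order id x)) ⟨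
    ∑[ y ∈ allFin v ] coverCount x y Bs + 1
      ≡⟨ ∑-all-but-one (allFin v) (allFin⁺ v) (∈-allFin x) covered-once ⟩
    coverCount x x Bs + length (allFin v)
      ≡⟨ cong₂ _+_ (coverCount-diagonal x) (length-tabulate id) ⟩
    1 * rep 3 x + 1 * rep 4 x + 1 * rep 5 x + v
      ∎)
    where
    open ≡-Reasoning
    rearrange : ∀ a b c → 1 * a + 1 * b + 1 * c + (2 * a + 3 * b + 4 * c + 1) ≡ 3 * a + 4 * b + 5 * c + 1
    rearrange = solve-∀

  module _ {C} (C∈Bs : C ∈ Bs) where

    private
      before after : List (Clique v)
      before = proj₁ (∈-∃++ C∈Bs)
      after  = proj₁ (proj₂ (∈-∃++ C∈Bs))

      Bs≡before++C∷after : Bs ≡ before ++ C ∷ after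
      Bs≡before++C∷after = proj₂ (proj₂ (∈-∃++ C∈Bs))

    others : List (Clique v)
    others = before ++ after

    ∑-at : ∀ f → ∑ Bs f ≡ f C + ∑ others f
    ∑-at f = trans (cong (λ L → ∑ L f) Bs≡before++C∷after) (∑-middle before C after f)

    meets-others-≤1 : ∀ {D} → D ∈ others → ∑[ y ∈ C ] mem y D ≤ 1
    meets-others-≤1 {D} D∈others = ∑≤1 C (unique C∈Bs) (λ y → mem≤1 y D) disjoint
      where
      disjoint : ∀ {y z} → y ∈ C → z ∈ C → y ≢ z → mem y D * mem z D ≡ 0
      disjoint {y} {z} y∈C z∈C y≢z = ∑≡0⇒≡0 others (suc-injective (begin
        1 + elsewhere                      ≡⟨ cong₂ (λ m n → m * n + elsewhere) (mem-∈ y∈C) (mem-∈ z∈C) ⟨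
        mem y C * mem z C + elsewhere      ≡⟨ ∑-at (λ E → mem y E * mem z E) ⟨
        ∑[ E ∈ Bs ] (mem y E * mem z E)    ≡⟨ coverCount≡∑ y z Bs ⟨
        coverCount y z Bs                  ≡⟨ covered-once y≢z ⟩
        1                                  ∎)) D∈others
        where
        open ≡-Reasoning
        elsewhere : ℕ
        elsewhere = ∑[ E ∈ others ] (mem y E * mem z E)

    ∑-rep-over-block : ∀ k → length C ≡ k → ∑ C (rep k) ≤ k + ∑ others (hasOrder k)
    ∑-rep-over-block k |C|≡k = begin
      ∑ C (rep k)
        ≡⟨ ∑-cong C (λ _ → ∑-at _) ⟩
      ∑[ y ∈ C ] (mem y C * hasOrder k C + ∑[ D ∈ others ] (mem y D * hasOrder k D))
        ≡⟨ ∑-+ C _ _ ⟩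
      ∑[ y ∈ C ] (mem y C * hasOrder k C) + ∑[ y ∈ C ] ∑[ D ∈ others ] (mem y D * hasOrder k D)
        ≡⟨ cong (_+ ∑[ y ∈ C ] ∑[ D ∈ others ] (mem y D * hasOrder k D)) own-block ⟩
      length C + ∑[ y ∈ C ] ∑[ D ∈ others ] (mem y D * hasOrder k D)
        ≡⟨ cong₂ _+_ |C|≡k (∑-swap C others _) ⟩
      k + ∑[ D ∈ others ] ∑[ y ∈ C ] (mem y D * hasOrder k D)
        ≤⟨ +-monoʳ-≤ k (∑-mono-≤ others meets-once) ⟩
      k + ∑ others (hasOrder k)
        ∎
      where
      open ≤-Reasoning
      own-block : ∑[ y ∈ C ] (mem y C * hasOrder k C) ≡ length C
      own-block = trans (∑-cong C (λ y∈C → cong₂ _*_ (mem-∈ y∈C) (𝟙-yes (length C ℕ.≟ k) |C|≡k)))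
                        (∑-one C)
      meets-once : ∀ {D} → D ∈ others → ∑[ y ∈ C ] (mem y D * hasOrder k D) ≤ hasOrder k D
      meets-once {D} D∈others = begin
        ∑[ y ∈ C ] (mem y D * hasOrder k D)   ≡⟨ ∑-*ʳ (hasOrder k D) C (λ y → mem y D) ⟩
        (∑[ y ∈ C ] mem y D) * hasOrder k D   ≤⟨ *-monoˡ-≤ (hasOrder k D) (meets-others-≤1 D∈others) ⟩
        1 * hasOrder k D                      ≡⟨ *-identityˡ (hasOrder k D) ⟩
        hasOrder k D                          ∎

    numOfOrder-at : ∀ k → length C ≡ k → numOfOrder k Bs ≡ 1 + ∑ others (hasOrder k)
    numOfOrder-at k |C|≡k = trans (numOfOrder≡∑ k Bs)
      (trans (∑-at (hasOrder k)) (cong (_+ ∑ others (hasOrder k)) (𝟙-yes (length C ℕ.≟ k) |C|≡k)))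

    rep-at-block : ∀ k → length C ≡ k → ∀ {y} → y ∈ C → 1 ≤ rep k y
    rep-at-block k |C|≡k {y} y∈C = begin
      1
        ≡⟨ cong₂ _*_ (mem-∈ y∈C) (𝟙-yes (length C ℕ.≟ k) |C|≡k) ⟨
      mem y C * hasOrder k C
        ≤⟨ m≤m+n _ _ ⟩
      mem y C * hasOrder k C + ∑[ D ∈ others ] (mem y D * hasOrder k D)
        ≡⟨ ∑-at _ ⟨
      rep k y
        ∎
      where open ≤-Reasoning

  module _ (v%4≡1 : v % 4 ≡ 1) (few-K₄ : numOfOrder 4 Bs ≤ 5) where

    rep₄≢1 : ∀ x → rep 4 x ≢ 1
    rep₄≢1 x = DegreeMod4.r₄≢1 {r₃ = rep 3 x} {r₅ = rep 5 x} v%4≡1 (degree x)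

    K₄-vertex-in-two : ∀ {C} → C ∈ Bs → length C ≡ 4 → ∀ {y} → y ∈ C → 2 ≤ rep 4 y
    K₄-vertex-in-two C∈Bs |C|≡4 {y} y∈C =
      ≤∧≢⇒< (rep-at-block C∈Bs 4 |C|≡4 y∈C) (λ 1≡rep → rep₄≢1 y (sym 1≡rep))

    rep₄≤2-on-K₄ : ∀ {C} → C ∈ Bs → length C ≡ 4 → ∀ {x} → x ∈ C → rep 4 x ≤ 2
    rep₄≤2-on-K₄ {C} C∈Bs |C|≡4 {x} x∈C = +-cancelʳ-≤ 8 (rep 4 x) 2 (begin
      rep 4 x + 8              ≡⟨ cong (λ n → rep 4 x + 2 * n) |C|≡4 ⟨
      rep 4 x + 2 * length C   ≤⟨ term+k*length≤∑+k 2 C (K₄-vertex-in-two C∈Bs |C|≡4) x∈C ⟩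
      ∑ C (rep 4) + 2          ≤⟨ +-monoˡ-≤ 2 (≤-trans (∑-rep-over-block C∈Bs 4 |C|≡4)
                                                       (+-monoʳ-≤ 4 others≤4)) ⟩
      8 + 2                    ∎)
      where
      open ≤-Reasoning
      others≤4 : ∑ (others C∈Bs) (hasOrder 4) ≤ 4
      others≤4 = ≤-pred (≤-trans (≤-reflexive (sym (numOfOrder-at C∈Bs 4 |C|≡4))) few-K₄)

    rep₄≤2 : ∀ x → rep 4 x ≤ 2
    rep₄≤2 x with rep 4 x ℕ.≟ 0
    ... | yes rep≡0 = ≤-trans (≤-reflexive rep≡0) z≤n
    ... | no rep≢0
      with C , C∈Bs , through ← ∑>0⇒>0 Bs (n≢0⇒n>0 rep≢0)
      with x∈C , |C|≡4 ← 𝟙*𝟙-pos (any? (x ≟_) C) (length C ℕ.≟ 4) through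
      = rep₄≤2-on-K₄ C∈Bs |C|≡4 x∈C

    rep₄≤2*rep₃ : ∀ x → rep 4 x ≤ 2 * rep 3 x
    rep₄≤2*rep₃ x =
      DegreeMod4.r₄≤2⇒r₄≤2*r₃ {r₃ = rep 3 x} {r₅ = rep 5 x} v%4≡1 (degree x) (rep₄≤2 x)

    K₄-incidences≤K₃-incidences : 4 * numOfOrder 4 Bs ≤ 6 * numOfOrder 3 Bs
    K₄-incidences≤K₃-incidences = begin
      4 * numOfOrder 4 Bs                   ≡⟨ ∑-rep 4 ⟨
      ∑[ x ∈ allFin v ] rep 4 x             ≤⟨ ∑-mono-≤ (allFin v) (λ {x} _ → rep₄≤2*rep₃ x) ⟩
      ∑[ x ∈ allFin v ] (2 * rep 3 x)       ≡⟨ ∑-*ˡ 2 (allFin v) (rep 3) ⟩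
      2 * ∑[ x ∈ allFin v ] rep 3 x         ≡⟨ cong (2 *_) (∑-rep 3) ⟩
      2 * (3 * numOfOrder 3 Bs)             ≡⟨ *-assoc 2 3 (numOfOrder 3 Bs) ⟨
      6 * numOfOrder 3 Bs                   ∎
      where open ≤-Reasoning

%20≡9∨17⇒%4≡1 : ∀ v → (v % 20 ≡ 9) ⊎ (v % 20 ≡ 17) → v % 4 ≡ 1
%20≡9∨17⇒%4≡1 v v%20 = trans (sym (m∣n⇒o%n%m≡o%m 4 20 v (divides 5 refl))) (residue v%20)
  where
  residue : (v % 20 ≡ 9) ⊎ (v % 20 ≡ 17) → v % 20 % 4 ≡ 1
  residue (inj₁ v%20≡9)  = cong (_% 4) v%20≡9
  residue (inj₂ v%20≡17) = cong (_% 4) v%20≡17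

lemma42 : (v : ℕ) → (v % 20 ≡ 9) ⊎ (v % 20 ≡ 17) →
    ¬ (Σ (List (Clique v)) λ Bs →
        IsCliqueDecomposition v Bs
        × numOfOrder 3 Bs ≡ 2
        × numOfOrder 4 Bs ≡ 5
        × numOfOrder 5 Bs ≡ (v * v ∸ v ∸ 72) / 20
        × length Bs ≡ 2 + 5 + (v * v ∸ v ∸ 72) / 20)
lemma42 v v%20 (Bs , decomposition , n₃ , n₄ , n₅ , |Bs|) =
  from-no (20 ℕ.≤? 12) (subst₂ _≤_ (cong (4 *_) n₄) (cong (6 *_) n₃) K₄-vs-K₃)
  where
  open Replication decomposition
    (orders-from-counts Bs (trans (cong₂ _+_ (cong₂ _+_ n₃ n₄) n₅) (sym |Bs|)))
  K₄-vs-K₃ : 4 * numOfOrder 4 Bs ≤ 6 * numOfOrder 3 Bs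
  K₄-vs-K₃ = K₄-incidences≤K₃-incidences (%20≡9∨17⇒%4≡1 v v%20) (≤-reflexive n₄)
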